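{- The minimum number of vertices of a periodic graph $\mathcal{G}$ with cop number $c(\mathcal{G})=3$ is at least $5$ and at most $8$.
   Context: A periodic graph with period $p\ge1$ is a sequence $\mathcal{G}=(G_0,\dots,G_{p-1})$ of finite undirected reflexive graphs $G_i=(V,E_i)$ on a common vertex set $V$ (its vertices), extended by $G_{i+p}=G_i$; its footprint $(V,\bigcup_iE_i)$ is assumed connected. Cops and Robber on $\mathcal{G}$ with $k$ cops (perfect information): cops choose starting vertices, then the robber; in each round $t=0,1,\dots$ each cop moves to a vertex of $N_{G_{t\bmod p}}[\text{its position}]$, then the robber likewise; the cops win if a cop ever moves onto the robber's vertex. The cop number $c(\mathcal{G})$ is the least $k$ such that $k$ cops have a winning strategy. -}

module Defs where

open import Data.Nat using (ℕ; zero; suc; _<_; _≤_)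
open import Data.Nat.DivMod using (_mod_)
open import Data.Fin using (Fin)
open import Data.Bool using (Bool; true)
open import Data.Product using (Σ; ∃; _×_)
open import Relation.Binary.PropositionalEquality using (_≡_)
open import Relation.Binary.Construct.Closure.ReflexiveTransitive using (Star)
open import Relation.Nullary using (¬_)

-- A periodic graph: vertex set Fin n, period p = suc p-1 ≥ 1,
-- snapshots G_i (i : Fin p) given by Boolean adjacency, each reflexive
-- and undirected; the footprint (union of all edge sets) is connected.
record PeriodicGraph : Set where
  field
    n      : ℕ
    p-1    : ℕ
    adj    : Fin (suc p-1) → Fin n → Fin n → Bool
    refl-adj : ∀ i v → adj i v v ≡ true
    sym-adj  : ∀ i u v → adj i u v ≡ adj i v u

  p : ℕ
  p = suc p-1

  FootEdge : Fin n → Fin n → Set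
  FootEdge u v = Σ (Fin p) λ i → adj i u v ≡ true

  field
    connected : ∀ u v → Star FootEdge u v

  -- G_t = G_{t mod p}; closed neighbourhood membership u ∈ N_{G_t}[v]
  InN : ℕ → Fin n → Fin n → Set
  InN t v u = adj (t mod p) v u ≡ true

module _ (G : PeriodicGraph) where
  open PeriodicGraph G

  -- CopWin k t c r : the position at the start of round t, cops at c,
  -- robber at r, cops to move (using G_t). The cops can force a capture.
  -- (Inductive: winning = forcing capture in finitely many rounds, which
  -- for this finite reachability game is equivalent to having a winning
  -- strategy.)
  data CopWin (k : ℕ) (t : ℕ) (c : Fin k → Fin n) (r : Fin n) : Set where
    capture : (c' : Fin k → Fin n) → (∀ j → InN t (c j) (c' j)) →
              (∃ λ j → c' j ≡ r) → CopWin k t c r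
    continue : (c' : Fin k → Fin n) → (∀ j → InN t (c j) (c' j)) →
               (∀ r' → InN t r r' → CopWin k (suc t) c' r') →
               CopWin k t c r

  CopsWin : ℕ → Set
  CopsWin k = ∃ λ (c : Fin k → Fin n) → ∀ (r : Fin n) → CopWin k 0 c r

  CopNumberIs : ℕ → Set
  CopNumberIs m = CopsWin m × (∀ k → k < m → ¬ CopsWin k)

{-# OPTIONS --safe #-}
-- Lower bound: on at most four vertices two cops win. With three or four vertices, take
-- a footprint edge uv, present at some time t₁, and the first time t₂ ≥ t₁ at which an
-- edge leaves {u, v}, say from w to z. With x the other end of uv, one cop sits on w and
-- the other on the fourth vertex (or also on w). The robber is confined to {x, z}; at t₁
-- the cop on w reaches x, and from t₁ on a robber at z cannot return to x before t₂,
-- when the cop on w reaches z.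
--
-- Upper bound: the 3-cube whose snapshots are the three perfect matchings of its
-- parallel classes, used in turn. Against two cops the robber maintains an explicit
-- safety invariant, and three cops starting at one corner catch him within four rounds;
-- both facts are verified by exhaustive evaluation of decision procedures.
module Submission where

open import Defs
open import Data.Bool using (Bool; true)
open import Data.Bool.Properties using (T-≡) renaming (_≟_ to _≟ᵇ_)
open import Data.Empty using (⊥; ⊥-elim)
open import Data.Fin using (Fin; zero; suc; toℕ; #_)
open import Data.Fin.Properties using (_≟_; any?; all?; toℕ-injective; toℕ-fromℕ<; toℕ<n)
open import Data.Nat using (ℕ; zero; suc; _+_; _*_; _≤_; _<_; _≤‴_; ≤‴-refl; ≤‴-step; z≤n; s≤s; _≤?_)
open import Data.Nat.DivMod using (_mod_; _%_; [m+kn]%n≡m%n; [m+n]%n≡m%n; m<n⇒m%n≡m; %-congˡ)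
open import Data.Nat.Properties
  using (≤-refl; ≤-trans; ≤-pred; m≤n⇒m≤1+n; n≤1+n; m≤m*n; m≤n+m; <⇒≱; ≰⇒>; m≤n⇒m<n∨m≡n;
         ≤⇒≤‴; ≤‴⇒≤; +-comm)
open import Data.Product using (Σ; ∃; ∃₂; _×_; _,_; proj₁; proj₂)
open import Data.Sum using (_⊎_; inj₁; inj₂; [_,_]′)
open import Data.Vec.Functional using (_∷_; []; head)
open import Function using (id; _∘_; Equivalence)
open import Relation.Binary using (Rel)
open import Relation.Binary.Construct.Closure.ReflexiveTransitive using (Star; ε; _◅_; _◅◅_; reverse)
open import Relation.Binary.PropositionalEquality using (_≡_; _≢_; refl; sym; trans; cong; subst; subst₂;
  module ≡-Reasoning)
open import Relation.Nullary using (Dec; yes; no; ¬_; ¬?)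
open import Relation.Nullary.Decidable using (⌊_⌋; _×-dec_; _⊎-dec_; _→-dec_; from-yes; toWitness; fromWitness; decidable-stable)
open import Relation.Unary using (Pred; Decidable)

module _ {a ℓ p} {A : Set a} {_⟶_ : Rel A ℓ} {P : Pred A p} (P? : Decidable P) where

  Star-crossing : ∀ {x y} → Star _⟶_ x y → P x → ¬ P y → ∃₂ λ u v → P u × ¬ P v × u ⟶ v
  Star-crossing ε Px ¬Py = ⊥-elim (¬Py Px)
  Star-crossing (_◅_ {j = m} x⟶m m⟶⋆y) Px ¬Py with P? m
  ... | yes Pm = Star-crossing m⟶⋆y Pm ¬Py
  ... | no ¬Pm = _ , m , Px , ¬Pm , x⟶m

module _ {p} {P : Pred ℕ p} (P? : Decidable P) where

  first-from : ∀ {t T} → t ≤ T → P T → ∃ λ t′ → t ≤ t′ × P t′ × (∀ {s} → t ≤ s → s < t′ → ¬ P s)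
  first-from t≤T PT = go (≤⇒≤‴ t≤T)
    where
    found : ∀ {t} → P t → ∃ λ t′ → t ≤ t′ × P t′ × (∀ {s} → t ≤ s → s < t′ → ¬ P s)
    found Pt = _ , ≤-refl , Pt , λ t≤s s<t → ⊥-elim (<⇒≱ s<t t≤s)

    go : ∀ {t} → t ≤‴ _ → ∃ λ t′ → t ≤ t′ × P t′ × (∀ {s} → t ≤ s → s < t′ → ¬ P s)
    go ≤‴-refl = found PT
    go {t} (≤‴-step t<T) with P? t
    ... | yes Pt = found Pt
    ... | no ¬Pt with go t<T
    ...   | t′ , t<t′ , Pt′ , before = t′ , ≤-trans (n≤1+n t) t<t′ , Pt′ , earlier
      where
      earlier : ∀ {s} → t ≤ s → s < t′ → ¬ P s
      earlier t≤s s<t′ with m≤n⇒m<n∨m≡n t≤s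
      ... | inj₁ t<s = before t<s s<t′
      ... | inj₂ refl = ¬Pt

mod-toℕ+multiple : ∀ {q} (i : Fin (suc q)) m → (toℕ i + m * suc q) mod suc q ≡ i
mod-toℕ+multiple {q} i m = toℕ-injective (begin
  toℕ ((toℕ i + m * suc q) mod suc q) ≡⟨ toℕ-fromℕ< _ ⟩
  (toℕ i + m * suc q) % suc q         ≡⟨ [m+kn]%n≡m%n (toℕ i) m (suc q) ⟩
  toℕ i % suc q                       ≡⟨ m<n⇒m%n≡m (toℕ<n i) ⟩
  toℕ i                               ∎)
  where open ≡-Reasoning

mod-period+ : ∀ q t → (suc q + t) mod suc q ≡ t mod suc q
mod-period+ q t = toℕ-injective (begin
  toℕ ((suc q + t) mod suc q) ≡⟨ toℕ-fromℕ< _ ⟩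
  (suc q + t) % suc q         ≡⟨ %-congˡ (+-comm (suc q) t) ⟩
  (t + suc q) % suc q         ≡⟨ [m+n]%n≡m%n t (suc q) ⟩
  t % suc q                   ≡⟨ toℕ-fromℕ< _ ⟨
  toℕ (t mod suc q)           ∎)
  where open ≡-Reasoning

AvoidsPairs : ℕ → Set
AvoidsPairs n = (a b : Fin n) → ∃ λ y → y ≢ a × y ≢ b

avoidsPairs? : ∀ n → Dec (AvoidsPairs n)
avoidsPairs? n = all? λ a → all? λ b → any? λ y → ¬? (y ≟ a) ×-dec ¬? (y ≟ b)

CoveredByFour : ℕ → Set
CoveredByFour n = (a b c : Fin n) → b ≢ a → c ≢ a → c ≢ b →
  ∃ λ d → ∀ r → r ≡ a ⊎ r ≡ d ⊎ r ≡ b ⊎ r ≡ c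

coveredByFour? : ∀ n → Dec (CoveredByFour n)
coveredByFour? n = all? λ a → all? λ b → all? λ c →
  ¬? (b ≟ a) →-dec ¬? (c ≟ a) →-dec ¬? (c ≟ b) →-dec
  any? λ d → all? λ r → r ≟ a ⊎-dec r ≟ d ⊎-dec r ≟ b ⊎-dec r ≟ c

module Game (G : PeriodicGraph) where
  open PeriodicGraph G

  InN-refl : ∀ t v → InN t v v
  InN-refl t v = refl-adj (t mod p) v

  InN-sym : ∀ t {u v} → InN t u v → InN t v u
  InN-sym t {u} {v} uv = trans (sym (sym-adj (t mod p) u v)) uv

  InN-periodic : ∀ {i u v} m → adj i u v ≡ true → InN (toℕ i + m * p) u v
  InN-periodic {i} {u} {v} m uv = subst (λ j → adj j u v ≡ true) (sym (mod-toℕ+multiple i m)) uv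

  module _ {k : ℕ} where

    CopWin-occupied : ∀ {t c r} → (∃ λ j → c j ≡ r) → CopWin G k t c r
    CopWin-occupied {t} {c} = capture c (λ j → InN-refl t (c j))

    CopWin-wait : ∀ {t c r} → (∀ r′ → InN t r r′ → CopWin G k (suc t) c r′) → CopWin G k t c r
    CopWin-wait {t} {c} = continue c (λ j → InN-refl t (c j))

    CopWin-extraCop : ∀ x {t c r} → CopWin G k t c r → CopWin G (suc k) t (x ∷ c) r
    CopWin-extraCop x {t} (capture c′ moves (j , caught)) =
      capture (x ∷ c′) (λ { zero → InN-refl t x ; (suc j) → moves j }) (suc j , caught)
    CopWin-extraCop x {t} (continue c′ moves win) =
      continue (x ∷ c′) (λ { zero → InN-refl t x ; (suc j) → moves j })
               (λ r′ rr′ → CopWin-extraCop x (win r′ rr′))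

    CopsWin-covering : (c : Fin k → Fin n) → (∀ r → ∃ λ j → c j ≡ r) → CopsWin G k
    CopsWin-covering c covers = c , λ r → CopWin-occupied (covers r)

  CopWin-adjacent : ∀ {k t c r} → InN t (head c) r → CopWin G (suc k) t c r
  CopWin-adjacent {t = t} {c} {r} cr =
    capture (r ∷ c ∘ suc) (λ { zero → cr ; (suc j) → InN-refl t (c (suc j)) }) (zero , refl)

  ¬CopWin-copless : ∀ {t c r} → ¬ CopWin G 0 t c r
  ¬CopWin-copless (capture _ _ (() , _))
  ¬CopWin-copless {t} {r = r} (continue _ _ win) = ¬CopWin-copless (win r (InN-refl t r))

  CopsWin-mono : Fin n → ∀ {k l} → k ≤ l → CopsWin G k → CopsWin G l
  CopsWin-mono x {l = l} k≤l (c , win) = go (≤⇒≤‴ k≤l) c win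
    where
    go : ∀ {k} → k ≤‴ l → (c : Fin k → Fin n) → (∀ r → CopWin G k 0 c r) → CopsWin G l
    go ≤‴-refl c win = c , win
    go (≤‴-step k<l) c win = go k<l (x ∷ c) (CopWin-extraCop x ∘ win)

  copNumberIs : Fin n → ∀ {m} → CopsWin G (suc m) → ¬ CopsWin G m → CopNumberIs G (suc m)
  copNumberIs x win ¬win = win , λ k k<1+m kWin → ¬win (CopsWin-mono x (≤-pred k<1+m) kWin)

  ¬CopsWin-by-invariant : ∀ {k} (Safe : ℕ → (Fin k → Fin n) → Fin n → Set) →
    (∀ t c r → Safe t c r → ∀ c′ → (∀ j → InN t (c j) (c′ j)) →
       (∀ j → c′ j ≢ r) × ∃ λ r′ → InN t r r′ × Safe (suc t) c′ r′) →
    (∀ c → ∃ λ r → Safe 0 c r) → ¬ CopsWin G k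
  ¬CopsWin-by-invariant {k} Safe escape start (c , win) = evade (proj₂ (start c)) (win _)
    where
    evade : ∀ {t c r} → Safe t c r → ¬ CopWin G k t c r
    evade {t} {c} {r} safe (capture c′ moves (j , caught)) = proj₁ (escape t c r safe c′ moves) j caught
    evade {t} {c} {r} safe (continue c′ moves win) with escape t c r safe c′ moves
    ... | _ , r′ , rr′ , safe′ = evade safe′ (win r′ rr′)

  CopWin-confined : ∀ {k c} (R : ℕ → Fin n → Set) {t₂} →
    (∀ {t r r′} → t < t₂ → R t r → InN t r r′ → (∃ λ j → c j ≡ r′) ⊎ R (suc t) r′) →
    (∀ {r} → R t₂ r → CopWin G k t₂ c r) →
    ∀ {t r} → t ≤ t₂ → R t r → CopWin G k t c r
  CopWin-confined {k} {c} R {t₂} stays caught t≤t₂ = go (≤⇒≤‴ t≤t₂)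
    where
    go : ∀ {t r} → t ≤‴ t₂ → R t r → CopWin G k t c r
    go ≤‴-refl Rr = caught Rr
    go (≤‴-step t<t₂) Rr =
      CopWin-wait λ r′ rr′ → [ CopWin-occupied , go t<t₂ ]′ (stays (≤‴⇒≤ t<t₂) Rr rr′)

  twoCops-trap : ∀ {w s x z t₁ t₂} → (∀ r → r ≡ w ⊎ r ≡ s ⊎ r ≡ x ⊎ r ≡ z) →
    t₁ ≤ t₂ → InN t₁ w x → InN t₂ w z → (∀ {t} → t₁ ≤ t → t < t₂ → ¬ InN t z x) →
    CopsWin G 2
  twoCops-trap {w} {s} {x} {z} {t₁} {t₂} covers t₁≤t₂ wx wz z↛x = cops , start
    where
    cops : Fin 2 → Fin n
    cops = w ∷ s ∷ []

    hideout : ∀ r → (∃ λ j → cops j ≡ r) ⊎ (r ≡ x ⊎ r ≡ z)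
    hideout r with covers r
    ... | inj₁ r≡w = inj₁ (zero , sym r≡w)
    ... | inj₂ (inj₁ r≡s) = inj₁ (suc zero , sym r≡s)
    ... | inj₂ (inj₂ r∈xz) = inj₂ r∈xz

    stuckAtZ : ∀ {t r} → t ≤ t₂ → t₁ ≤ t × r ≡ z → CopWin G 2 t cops r
    stuckAtZ = CopWin-confined (λ t r → t₁ ≤ t × r ≡ z) stays λ { (_ , refl) → CopWin-adjacent wz }
      where
      stays : ∀ {t r r′} → t < t₂ → t₁ ≤ t × r ≡ z → InN t r r′ →
              (∃ λ j → cops j ≡ r′) ⊎ (t₁ ≤ suc t × r′ ≡ z)
      stays {r′ = r′} t<t₂ (t₁≤t , refl) zr′ with hideout r′
      ... | inj₁ occupied = inj₁ occupied
      ... | inj₂ (inj₁ refl) = ⊥-elim (z↛x t₁≤t t<t₂ zr′)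
      ... | inj₂ (inj₂ refl) = inj₂ (m≤n⇒m≤1+n t₁≤t , refl)

    caughtAtT₁ : ∀ {r} → r ≡ x ⊎ r ≡ z → CopWin G 2 t₁ cops r
    caughtAtT₁ (inj₁ refl) = CopWin-adjacent wx
    caughtAtT₁ (inj₂ refl) = stuckAtZ t₁≤t₂ (≤-refl , refl)

    hidden : ∀ {t r} → t ≤ t₁ → r ≡ x ⊎ r ≡ z → CopWin G 2 t cops r
    hidden = CopWin-confined (λ _ r → r ≡ x ⊎ r ≡ z) (λ {_} {_} {r′} _ _ _ → hideout r′) caughtAtT₁

    start : ∀ r → CopWin G 2 0 cops r
    start r = [ CopWin-occupied , hidden z≤n ]′ (hideout r)

  InPair : Fin n → Fin n → Fin n → Set
  InPair u v r = r ≡ u ⊎ r ≡ v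

  inPair? : ∀ u v → Decidable (InPair u v)
  inPair? u v r = r ≟ u ⊎-dec r ≟ v

  Leaves : Fin n → Fin n → ℕ → Set
  Leaves u v t = ∃₂ λ w z → InPair u v w × ¬ InPair u v z × InN t w z

  leaves? : ∀ u v → Decidable (Leaves u v)
  leaves? u v t = any? λ w → any? λ z →
    inPair? u v w ×-dec ¬? (inPair? u v z) ×-dec adj (t mod p) w z ≟ᵇ true

  footprintEdge-from : ∀ u → (∃ λ y → y ≢ u) → ∃₂ λ v i → v ≢ u × adj i u v ≡ true
  footprintEdge-from u (y , y≢u) with Star-crossing (_≟ u) (connected u y) refl y≢u
  ... | _ , v , refl , v≢u , i , uv = v , i , v≢u , uv

  leaves-eventually : ∀ {u v} → (∃ λ z → ¬ InPair u v z) → ∀ t → ∃ λ T → t ≤ T × Leaves u v T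
  leaves-eventually {u} {v} (z , z∉) t with Star-crossing (inPair? u v) (connected u z) (inj₁ refl) z∉
  ... | w , z′ , w∈ , z′∉ , j , wz′ =
    toℕ j + t * p , ≤-trans (m≤m*n t p) (m≤n+m (t * p) (toℕ j)) , w , z′ , w∈ , z′∉ , InN-periodic t wz′

  otherEnd : ∀ t {u v w} → v ≢ u → InN t u v → InPair u v w → ∃ λ x → InPair u v x × x ≢ w × InN t w x
  otherEnd _ v≢u uv (inj₁ refl) = _ , inj₂ refl , v≢u , uv
  otherEnd t v≢u uv (inj₂ refl) = _ , inj₁ refl , v≢u ∘ sym , InN-sym t uv

  twoCopsWin : Fin n → AvoidsPairs n → CoveredByFour n → CopsWin G 2
  twoCopsWin u avoid cover with avoid u u
  ... | y , y≢u , _ with footprintEdge-from u (y , y≢u)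
  ... | v , i , v≢u , uv with avoid u v
  ... | z₀ , z₀≢u , z₀≢v with leaves-eventually (z₀ , [ z₀≢u , z₀≢v ]′) (toℕ i + 0 * p)
  ... | T , t₁≤T , leavesT with first-from (leaves? u v) t₁≤T leavesT
  ... | t₂ , t₁≤t₂ , (w , z , w∈ , z∉ , wz) , stillInside
    with otherEnd (toℕ i + 0 * p) v≢u (InN-periodic 0 uv) w∈
  ... | x , x∈ , x≢w , wx =
    twoCops-trap (proj₂ (cover w x z x≢w (separated w∈) (separated x∈))) t₁≤t₂ wx wz z↛x
    where
    separated : ∀ {a} → InPair u v a → z ≢ a
    separated a∈ refl = z∉ a∈

    z↛x : ∀ {t} → toℕ i + 0 * p ≤ t → t < t₂ → ¬ InN t z x
    z↛x {t} t₁≤t t<t₂ zx = stillInside t₁≤t t<t₂ (x , z , x∈ , z∉ , InN-sym t zx)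

atMostTwoCopsWin : (G : PeriodicGraph) → PeriodicGraph.n G ≤ 4 → ∃ λ k → k ≤ 2 × CopsWin G k
atMostTwoCopsWin record { n = 0 } _ = 0 , z≤n , (λ ()) , λ ()
atMostTwoCopsWin G@record { n = 1 } _ = 2 , ≤-refl , Game.CopsWin-covering G (λ _ → zero) λ { zero → zero , refl }
atMostTwoCopsWin G@record { n = 2 } _ = 2 , ≤-refl , Game.CopsWin-covering G id λ r → r , refl
atMostTwoCopsWin G@record { n = 3 } _ =
  2 , ≤-refl , Game.twoCopsWin G zero (from-yes (avoidsPairs? 3)) (from-yes (coveredByFour? 3))
atMostTwoCopsWin G@record { n = 4 } _ =
  2 , ≤-refl , Game.twoCopsWin G zero (from-yes (avoidsPairs? 4)) (from-yes (coveredByFour? 4))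
atMostTwoCopsWin record { n = suc (suc (suc (suc (suc _)))) } (s≤s (s≤s (s≤s (s≤s ()))))

copNumber3⇒5≤n : (G : PeriodicGraph) → CopNumberIs G 3 → 5 ≤ PeriodicGraph.n G
copNumber3⇒5≤n G (_ , fewerLose) = decidable-stable (5 ≤? _) λ 5≰n →
  let k , k≤2 , kWin = atMostTwoCopsWin G (≤-pred (≰⇒> 5≰n)) in fewerLose k (s≤s k≤2) kWin

-- Vertex v stands for the binary expansion of toℕ v, and toggle d flips its bit d.
toggle : Fin 3 → Fin 8 → Fin 8
toggle = (# 1 ∷ # 0 ∷ # 3 ∷ # 2 ∷ # 5 ∷ # 4 ∷ # 7 ∷ # 6 ∷ [])
       ∷ (# 2 ∷ # 3 ∷ # 0 ∷ # 1 ∷ # 6 ∷ # 7 ∷ # 4 ∷ # 5 ∷ [])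
       ∷ (# 4 ∷ # 5 ∷ # 6 ∷ # 7 ∷ # 0 ∷ # 1 ∷ # 2 ∷ # 3 ∷ [])
       ∷ []

cubeNbr : Fin 3 → Fin 8 → Fin 2 → Fin 8
cubeNbr d v = v ∷ toggle d v ∷ []

cubeAdj : Fin 3 → Fin 8 → Fin 8 → Bool
cubeAdj d u v = ⌊ any? (λ i → cubeNbr d u i ≟ v) ⌋

cubeAdj-nbr : ∀ d u v → cubeAdj d u v ≡ true → ∃ λ i → cubeNbr d u i ≡ v
cubeAdj-nbr d u v = toWitness {a? = any? λ i → cubeNbr d u i ≟ v} ∘ Equivalence.from T-≡

nbr-cubeAdj : ∀ d u i → cubeAdj d u (cubeNbr d u i) ≡ true
nbr-cubeAdj d u i = Equivalence.to T-≡ (fromWitness {a? = any? λ j → cubeNbr d u j ≟ cubeNbr d u i} (i , refl))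

cubeAdj-sym : ∀ d u v → cubeAdj d u v ≡ cubeAdj d v u
cubeAdj-sym = from-yes (all? λ d → all? λ u → all? λ v → cubeAdj d u v ≟ᵇ cubeAdj d v u)

CubeEdge : Fin 8 → Fin 8 → Set
CubeEdge u v = Σ (Fin 3) λ d → cubeAdj d u v ≡ true

cube-fromOrigin : ∀ v → Star CubeEdge (# 0) v
cube-fromOrigin v with from-yes (all? λ v → any? λ i → any? λ j → any? λ l →
                                   cubeNbr (# 0) (cubeNbr (# 1) (cubeNbr (# 2) (# 0) i) j) l ≟ v) v
... | i , j , l , refl = via (# 2) i (via (# 1) j (via (# 0) l ε))
  where
  via : ∀ d {u w} i → Star CubeEdge (cubeNbr d u i) w → Star CubeEdge u w
  via d {u} i path = (d , nbr-cubeAdj d u i) ◅ path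

Cube : PeriodicGraph
Cube = record
  { n = 8 ; p-1 = 2 ; adj = cubeAdj
  ; refl-adj = λ d v → nbr-cubeAdj d v zero
  ; sym-adj = cubeAdj-sym
  ; connected = λ u v → reverse CubeEdge-sym (cube-fromOrigin u) ◅◅ cube-fromOrigin v
  }
  where
  CubeEdge-sym : ∀ {u v} → CubeEdge u v → CubeEdge v u
  CubeEdge-sym {u} {v} (d , uv) = d , trans (cubeAdj-sym d v u) uv

open PeriodicGraph Cube using (InN)

next : Fin 3 → Fin 3
next = # 1 ∷ # 2 ∷ # 0 ∷ []

suc-mod3 : ∀ t → suc t mod 3 ≡ next (t mod 3)
suc-mod3 0 = refl
suc-mod3 1 = refl
suc-mod3 2 = refl
suc-mod3 (suc (suc (suc t))) = begin
  (3 + suc t) mod 3  ≡⟨ mod-period+ 2 (suc t) ⟩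
  suc t mod 3        ≡⟨ suc-mod3 t ⟩
  next (t mod 3)     ≡⟨ cong next (mod-period+ 2 t) ⟨
  next ((3 + t) mod 3) ∎
  where open ≡-Reasoning

_∉N[_,_] : Fin 8 → Fin 3 → Fin 8 → Set
r ∉N[ d , a ] = ∀ i → cubeNbr d a i ≢ r

-- A cop resting at a would, in the next snapshot, be matched to one of the robber's
-- two current options r and toggle d r.
Threatens : Fin 3 → Fin 8 → Fin 8 → Set
Threatens d a r = ∃ λ i → toggle (next d) a ≡ cubeNbr d r i

CubeSafe : Fin 3 → Fin 8 → Fin 8 → Fin 8 → Set
CubeSafe d a b r = r ∉N[ d , a ] × r ∉N[ d , b ] × ¬ (Threatens d a r × Threatens d b r)

cubeSafe? : ∀ d a b r → Dec (CubeSafe d a b r)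
cubeSafe? d a b r =
  all? (λ i → ¬? (cubeNbr d a i ≟ r)) ×-dec all? (λ i → ¬? (cubeNbr d b i ≟ r)) ×-dec
  ¬? (any? (λ i → toggle (next d) a ≟ cubeNbr d r i) ×-dec any? (λ i → toggle (next d) b ≟ cubeNbr d r i))

-- Opaque: unfolding these proofs during conversion checking re-runs the decision procedure.
opaque
  cubeSafe-escape : ∀ d a b r → CubeSafe d a b r → ∀ i j →
    ∃ λ l → CubeSafe (next d) (cubeNbr d a i) (cubeNbr d b j) (cubeNbr d r l)
  cubeSafe-escape = from-yes (all? λ d → all? λ a → all? λ b → all? λ r → cubeSafe? d a b r →-dec
    all? λ i → all? λ j → any? λ l → cubeSafe? (next d) (cubeNbr d a i) (cubeNbr d b j) (cubeNbr d r l))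

  cubeSafe-start : ∀ a b → ∃ λ r → CubeSafe (# 0) a b r
  cubeSafe-start = from-yes (all? λ a → all? λ b → any? λ r → cubeSafe? (# 0) a b r)

cube-twoCopsLose : ¬ CopsWin Cube 2
cube-twoCopsLose = Game.¬CopsWin-by-invariant Cube Safe escape λ c → cubeSafe-start (c zero) (c (suc zero))
  where
  Safe : ℕ → (Fin 2 → Fin 8) → Fin 8 → Set
  Safe t c r = CubeSafe (t mod 3) (c zero) (c (suc zero)) r

  escape : ∀ t c r → Safe t c r → ∀ c′ → (∀ j → InN t (c j) (c′ j)) →
           (∀ j → c′ j ≢ r) × ∃ λ r′ → InN t r r′ × Safe (suc t) c′ r′
  escape t c r safe@(r∉a , r∉b , _) c′ moves
    with cubeAdj-nbr (t mod 3) (c zero) (c′ zero) (moves zero)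
       | cubeAdj-nbr (t mod 3) (c (suc zero)) (c′ (suc zero)) (moves (suc zero))
  ... | i , a′ | j , b′ with cubeSafe-escape (t mod 3) (c zero) (c (suc zero)) r safe i j
  ... | l , safe′ rewrite suc-mod3 t =
    notCaught , cubeNbr (t mod 3) r l , nbr-cubeAdj (t mod 3) r l ,
    subst₂ (λ a b → CubeSafe (next (t mod 3)) a b (cubeNbr (t mod 3) r l)) a′ b′ safe′
    where
    notCaught : ∀ j → c′ j ≢ r
    notCaught zero = r∉a i ∘ trans a′
    notCaught (suc zero) = r∉b j ∘ trans b′

CubeCatch : ℕ → Fin 3 → Fin 8 → Fin 8 → Fin 8 → Fin 8 → Set
CubeCatch zero d a b c r = ⊥
CubeCatch (suc h) d a b c r = ∃ λ i → ∃ λ j → ∃ λ l →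
  (r ≡ cubeNbr d a i ⊎ r ≡ cubeNbr d b j ⊎ r ≡ cubeNbr d c l) ⊎
  (∀ m → CubeCatch h (next d) (cubeNbr d a i) (cubeNbr d b j) (cubeNbr d c l) (cubeNbr d r m))

cubeCatch? : ∀ h d a b c r → Dec (CubeCatch h d a b c r)
cubeCatch? zero d a b c r = no λ ()
cubeCatch? (suc h) d a b c r = any? λ i → any? λ j → any? λ l →
  (r ≟ cubeNbr d a i ⊎-dec r ≟ cubeNbr d b j ⊎-dec r ≟ cubeNbr d c l) ⊎-dec
  all? λ m → cubeCatch? h (next d) (cubeNbr d a i) (cubeNbr d b j) (cubeNbr d c l) (cubeNbr d r m)

cubeMoves : ∀ t a b c i j l k → let d = t mod 3 in
  InN t ((a ∷ b ∷ c ∷ []) k) ((cubeNbr d a i ∷ cubeNbr d b j ∷ cubeNbr d c l ∷ []) k)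
cubeMoves t a b c i j l zero = nbr-cubeAdj (t mod 3) a i
cubeMoves t a b c i j l (suc zero) = nbr-cubeAdj (t mod 3) b j
cubeMoves t a b c i j l (suc (suc zero)) = nbr-cubeAdj (t mod 3) c l

cubeCatch-sound : ∀ h t {a b c r} → CubeCatch h (t mod 3) a b c r → CopWin Cube 3 t (a ∷ b ∷ c ∷ []) r
cubeCatch-sound (suc h) t {a} {b} {c} (i , j , l , inj₁ hit) = capture _ (cubeMoves t a b c i j l) (caught hit)
  where
  caught : ∀ {r a b c} → r ≡ a ⊎ r ≡ b ⊎ r ≡ c → ∃ λ k → (a ∷ b ∷ c ∷ []) k ≡ r
  caught (inj₁ refl) = zero , refl
  caught (inj₂ (inj₁ refl)) = suc zero , refl
  caught (inj₂ (inj₂ refl)) = suc (suc zero) , refl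
cubeCatch-sound (suc h) t {a} {b} {c} {r} (i , j , l , inj₂ win) =
  continue _ (cubeMoves t a b c i j l) robberMoves
  where
  d = t mod 3
  robberMoves : ∀ r′ → InN t r r′ → CopWin Cube 3 (suc t) (cubeNbr d a i ∷ cubeNbr d b j ∷ cubeNbr d c l ∷ []) r′
  robberMoves r′ rr′ with cubeAdj-nbr d r r′ rr′
  ... | m , refl = cubeCatch-sound h (suc t)
    (subst (λ e → CubeCatch h e (cubeNbr d a i) (cubeNbr d b j) (cubeNbr d c l) (cubeNbr d r m)) (sym (suc-mod3 t)) (win m))

opaque
  cubeCatch-fromOrigin : ∀ r → CubeCatch 4 (# 0) (# 0) (# 0) (# 0) r
  cubeCatch-fromOrigin = from-yes (all? λ r → cubeCatch? 4 (# 0) (# 0) (# 0) (# 0) r)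

cube-threeCopsWin : CopsWin Cube 3
cube-threeCopsWin = (# 0 ∷ # 0 ∷ # 0 ∷ []) , λ r → cubeCatch-sound 4 0 (cubeCatch-fromOrigin r)

cube-copNumber : CopNumberIs Cube 3
cube-copNumber = Game.copNumberIs Cube (# 0) cube-threeCopsWin cube-twoCopsLose

theorem1 : ((G : PeriodicGraph) → CopNumberIs G 3 → 5 ≤ PeriodicGraph.n G)
           × Σ PeriodicGraph (λ G → CopNumberIs G 3 × PeriodicGraph.n G ≤ 8)
theorem1 = copNumber3⇒5≤n , Cube , cube-copNumber , ≤-refl
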